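{- Let $a,b$ be integers with $a > b \ge 0$, let $T = \{x+yi \in \mathbb{Z}[i] : 0 \le x < b,\ -b \le y < 0\}$ and $S = \{x+yi \in \mathbb{Z}[i] : 0 \le x,y < a\}$. If $\alpha+\beta i$ and $c+di$ are distinct elements of $S\cup T$, then $\alpha+\beta i \not\equiv c+di \pmod{a+bi}$. -}

module Defs where

open import Data.Integer using (ℤ; _+_; _*_; _-_; -_; _≤_; _<_; +_)
open import Data.Product using (_×_; ∃; _,_)
open import Data.Sum using (_⊎_)
open import Relation.Binary.PropositionalEquality using (_≡_)

record ℤ[i] : Set where
  constructor _+_i
  field
    re : ℤ
    im : ℤ
open ℤ[i] public

_-ᵍ_ : ℤ[i] → ℤ[i] → ℤ[i]
(a + b i) -ᵍ (c + d i) = (a - c) + (b - d) i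

_*ᵍ_ : ℤ[i] → ℤ[i] → ℤ[i]
(a + b i) *ᵍ (c + d i) = (a * c - b * d) + (a * d + b * c) i

_∣ᵍ_ : ℤ[i] → ℤ[i] → Set
m ∣ᵍ z = ∃ λ (q : ℤ[i]) → z ≡ m *ᵍ q

_≡_mod_ : ℤ[i] → ℤ[i] → ℤ[i] → Set
z ≡ w mod m = m ∣ᵍ (z -ᵍ w)

inT : ℤ → ℤ[i] → Set
inT b (x + y i) = (+ 0 ≤ x × x < b) × (- b ≤ y × y < + 0)

inS : ℤ → ℤ[i] → Set
inS a (x + y i) = (+ 0 ≤ x × x < a) × (+ 0 ≤ y × y < a)

inS∪T : ℤ → ℤ → ℤ[i] → Set
inS∪T a b z = inS a z ⊎ inT b z

{-# OPTIONS --safe #-}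
-- If z ≡ w mod (a + b i) then z − w = (a + b i)(p + q i), whose coordinates are a p − b q and
-- a q + b p. When z and w both lie in S (or both in T, using b < a) the coordinates of z − w
-- lie strictly between −a and a, and a sign analysis of p and q shows that this forces
-- p = q = 0. When z ∈ S and w ∈ T the coordinates lie in (−b, a) × (0, a + b), and the same
-- sign analysis shows that no multiple of a + b i lies there; the case z ∈ T, w ∈ S is
-- reduced to this one by symmetry of the congruence.
module Submission where

open import Defs
open import Data.Integer
  using (ℤ; +_; +0; +[1+_]; -[1+_]; 0ℤ; 1ℤ; -1ℤ; _+_; _-_; _*_; -_; _≤_; _<_; NonNegative; nonNegative; +≤+; -≤-; -≤+)
open import Data.Integer.Properties
open import Data.Integer.Tactic.RingSolver using (solve-∀)
open import Data.Nat using (z≤n; s≤s)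
open import Data.Product using (_×_; _,_)
open import Data.Sum using (_⊎_; inj₁; inj₂)
open import Data.Empty using (⊥; ⊥-elim)
open import Relation.Binary.PropositionalEquality using (_≡_; refl; sym; trans; cong; cong₂; subst; module ≡-Reasoning)
open import Relation.Nullary using (¬_)

private
  variable
    j l l′ h h′ x y u v : ℤ
    z w m : ℤ[i]

i≤-j⇒j≤-i : ∀ {i j} → i ≤ - j → j ≤ - i
i≤-j⇒j≤-i {i} {j} i≤-j = subst (_≤ - i) (neg-involutive j) (neg-mono-≤ i≤-j)

≤0⊎1≤ : ∀ i → i ≤ 0ℤ ⊎ 1ℤ ≤ i
≤0⊎1≤ +0       = inj₁ ≤-refl
≤0⊎1≤ +[1+ _ ] = inj₂ (+≤+ (s≤s z≤n))
≤0⊎1≤ -[1+ _ ] = inj₁ -≤+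

module _ (i : ℤ) .{{_ : NonNegative i}} where

  i≤i*j : 1ℤ ≤ j → i ≤ i * j
  i≤i*j {j} 1≤j = subst (_≤ i * j) (*-identityʳ i) (*-monoˡ-≤-nonNeg i 1≤j)

  0≤i*j : 0ℤ ≤ j → 0ℤ ≤ i * j
  0≤i*j {j} 0≤j = subst (_≤ i * j) (*-zeroʳ i) (*-monoˡ-≤-nonNeg i 0≤j)

  i*j≤0 : j ≤ 0ℤ → i * j ≤ 0ℤ
  i*j≤0 {j} j≤0 = subst (i * j ≤_) (*-zeroʳ i) (*-monoˡ-≤-nonNeg i j≤0)

0ᵍ : ℤ[i]
0ᵍ = 0ℤ + 0ℤ i

-ᵍ_ : ℤ[i] → ℤ[i]
-ᵍ (x + y i) = (- x) + (- y) i

*ᵍ-zeroʳ : ∀ m → m *ᵍ 0ᵍ ≡ 0ᵍ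
*ᵍ-zeroʳ (a + b i) rewrite *-zeroʳ a | *-zeroʳ b = refl

*ᵍ-negʳ : ∀ m w → m *ᵍ (-ᵍ w) ≡ -ᵍ (m *ᵍ w)
*ᵍ-negʳ (a + b i) (c + d i) = cong₂ _+_i (re-neg a b c d) (im-neg a b c d)
  where
  re-neg : ∀ a b c d → a * - c - b * - d ≡ - (a * c - b * d)
  re-neg = solve-∀
  im-neg : ∀ a b c d → a * - d + b * - c ≡ - (a * d + b * c)
  im-neg = solve-∀

-ᵍ-anticomm : ∀ z w → w -ᵍ z ≡ -ᵍ (z -ᵍ w)
-ᵍ-anticomm (x + y i) (u + v i) = cong₂ _+_i (minus-anticomm x u) (minus-anticomm y v)
  where
  minus-anticomm : ∀ x u → u - x ≡ - (x - u)
  minus-anticomm = solve-∀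

-ᵍ≡0ᵍ⇒≡ : z -ᵍ w ≡ 0ᵍ → z ≡ w
-ᵍ≡0ᵍ⇒≡ {x + y i} {u + v i} eq =
  cong₂ _+_i (i-j≡0⇒i≡j x u (cong re eq)) (i-j≡0⇒i≡j y v (cong im eq))

≡mod-sym : z ≡ w mod m → w ≡ z mod m
≡mod-sym {z} {w} {m} (q , z-w≡mq) = -ᵍ q , (begin
  w -ᵍ z         ≡⟨ -ᵍ-anticomm z w ⟩
  -ᵍ (z -ᵍ w)    ≡⟨ cong -ᵍ_ z-w≡mq ⟩
  -ᵍ (m *ᵍ q)    ≡⟨ *ᵍ-negʳ m q ⟨
  m *ᵍ (-ᵍ q)    ∎)
  where open ≡-Reasoning

infix 4 _∈[_,_⟩ _∈⟨_,_⟩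

_∈[_,_⟩ : ℤ → ℤ → ℤ → Set
x ∈[ l , h ⟩ = l ≤ x × x < h

_∈⟨_,_⟩ : ℤ → ℤ → ℤ → Set
x ∈⟨ l , h ⟩ = l < x × x < h

Rect : (l h l′ h′ : ℤ) → ℤ[i] → Set
Rect l h l′ h′ z = re z ∈⟨ l , h ⟩ × im z ∈⟨ l′ , h′ ⟩

Square : ℤ → ℤ[i] → Set
Square r = Rect (- r) r (- r) r

-‿∈⟨⟩ : ∀ {l₁ h₁ l₂ h₂} → x ∈[ l₁ , h₁ ⟩ → y ∈[ l₂ , h₂ ⟩ → x - y ∈⟨ l₁ - h₂ , h₁ - l₂ ⟩
-‿∈⟨⟩ (l₁≤x , x<h₁) (l₂≤y , y<h₂) = +-mono-≤-< l₁≤x (neg-mono-< y<h₂) , +-mono-<-≤ x<h₁ (neg-mono-≤ l₂≤y)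

∈⟨⟩-cong : l ≡ l′ → h ≡ h′ → x ∈⟨ l , h ⟩ → x ∈⟨ l′ , h′ ⟩
∈⟨⟩-cong refl refl x∈ = x∈

∈⟨⟩-widen : l′ ≤ l → h ≤ h′ → x ∈⟨ l , h ⟩ → x ∈⟨ l′ , h′ ⟩
∈⟨⟩-widen l′≤l h≤h′ (l<x , x<h) = ≤-<-trans l′≤l l<x , <-≤-trans x<h h≤h′

-‿∈⟨-h′,h⟩ : x ∈[ 0ℤ , h ⟩ → y ∈[ 0ℤ , h′ ⟩ → x - y ∈⟨ - h′ , h ⟩
-‿∈⟨-h′,h⟩ {h = h} {h′ = h′} x∈ y∈ = ∈⟨⟩-cong (+-identityˡ (- h′)) (+-identityʳ h) (-‿∈⟨⟩ x∈ y∈)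

S-S-diff : ∀ {a} → inS a (x + y i) → inS a (u + v i) → Square a ((x + y i) -ᵍ (u + v i))
S-S-diff (x∈ , y∈) (u∈ , v∈) = -‿∈⟨-h′,h⟩ x∈ u∈ , -‿∈⟨-h′,h⟩ y∈ v∈

T-T-diff : ∀ {b} → inT b (x + y i) → inT b (u + v i) → Square b ((x + y i) -ᵍ (u + v i))
T-T-diff {b = b} (x∈ , y∈) (u∈ , v∈) =
  -‿∈⟨-h′,h⟩ x∈ u∈ ,
  ∈⟨⟩-cong (+-identityʳ (- b)) (trans (+-identityˡ (- - b)) (neg-involutive b)) (-‿∈⟨⟩ y∈ v∈)

S-T-diff : ∀ {a b} → inS a (x + y i) → inT b (u + v i) → Rect (- b) a 0ℤ (a + b) ((x + y i) -ᵍ (u + v i))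
S-T-diff {a = a} {b} (x∈ , y∈) (u∈ , v∈) =
  -‿∈⟨-h′,h⟩ x∈ u∈ , ∈⟨⟩-cong refl (cong (_+_ a) (neg-involutive b)) (-‿∈⟨⟩ y∈ v∈)

Square-mono : ∀ {r r′} → r ≤ r′ → Square r z → Square r′ z
Square-mono {r = r} {r′} r≤r′ (re∈ , im∈) = widen re∈ , widen im∈
  where
  widen : ∀ {x} → x ∈⟨ - r , r ⟩ → x ∈⟨ - r′ , r′ ⟩
  widen = ∈⟨⟩-widen (neg-mono-≤ r≤r′) r≤r′

module _ (a b : ℤ) .{{_ : NonNegative a}} .{{_ : NonNegative b}} where

  a≤a*p+b*q : ∀ {p q} → 1ℤ ≤ p → 0ℤ ≤ q → a ≤ a * p + b * q
  a≤a*p+b*q {p} {q} 1≤p 0≤q =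
    subst (_≤ a * p + b * q) (+-identityʳ a) (+-mono-≤ (i≤i*j a 1≤p) (0≤i*j b 0≤q))

  a≤a*p-b*q : ∀ {p q} → 1ℤ ≤ p → q ≤ 0ℤ → a ≤ a * p - b * q
  a≤a*p-b*q {p} {q} 1≤p q≤0 =
    subst (a ≤_) (cong (_+_ (a * p)) (sym (neg-distribʳ-* b q))) (a≤a*p+b*q 1≤p (neg-mono-≤ q≤0))

  a*p-b*q≤-a : ∀ {p q} → p ≤ -1ℤ → 0ℤ ≤ q → a * p - b * q ≤ - a
  a*p-b*q≤-a {p} {q} p≤-1 0≤q = i≤-j⇒j≤-i
    (subst (a ≤_) (cong re (*ᵍ-negʳ (a + b i) (p + q i))) (a≤a*p-b*q (neg-mono-≤ p≤-1) (neg-mono-≤ 0≤q)))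

  a*q+b*p≤-a : ∀ {p q} → p ≤ 0ℤ → q ≤ -1ℤ → a * q + b * p ≤ - a
  a*q+b*p≤-a {p} {q} p≤0 q≤-1 = i≤-j⇒j≤-i
    (subst (a ≤_) (cong im (*ᵍ-negʳ (a + b i) (p + q i))) (a≤a*p+b*q (neg-mono-≤ q≤-1) (neg-mono-≤ p≤0)))

  a+b≤a*q+b*p : ∀ {p q} → 1ℤ ≤ p → 1ℤ ≤ q → a + b ≤ a * q + b * p
  a+b≤a*q+b*p 1≤p 1≤q = +-mono-≤ (i≤i*j a 1≤q) (i≤i*j b 1≤p)

  a*p-b*q≤-b : ∀ {p q} → p ≤ 0ℤ → 1ℤ ≤ q → a * p - b * q ≤ - b
  a*p-b*q≤-b {p} {q} p≤0 1≤q =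
    subst (a * p - b * q ≤_) (+-identityˡ (- b)) (+-mono-≤ (i*j≤0 a p≤0) (neg-mono-≤ (i≤i*j b 1≤q)))

  a*q+b*p≤0 : ∀ {p q} → p ≤ 0ℤ → q ≤ 0ℤ → a * q + b * p ≤ 0ℤ
  a*q+b*p≤0 p≤0 q≤0 = +-mono-≤ (i*j≤0 a q≤0) (i*j≤0 b p≤0)

  -- Every p + q i ≠ 0 lies in one of the four quadrants {p ≥ 1, q ≤ 0}, {p ≥ 0, q ≥ 1} and their
  -- negatives; in each of them one coordinate of the multiple has absolute value at least a.
  multiple-in-square⇒0 : ∀ w → Square a ((a + b i) *ᵍ w) → w ≡ 0ᵍ
  multiple-in-square⇒0 (+0 + +0 i) _ = refl
  multiple-in-square⇒0 (+[1+ _ ] + +0 i) ((_ , re<a) , _) =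
    ⊥-elim (≤⇒≯ (a≤a*p-b*q (+≤+ (s≤s z≤n)) ≤-refl) re<a)
  multiple-in-square⇒0 (+[1+ _ ] + -[1+ _ ] i) ((_ , re<a) , _) =
    ⊥-elim (≤⇒≯ (a≤a*p-b*q (+≤+ (s≤s z≤n)) -≤+) re<a)
  multiple-in-square⇒0 (+0 + +[1+ _ ] i) (_ , (_ , im<a)) =
    ⊥-elim (≤⇒≯ (a≤a*p+b*q (+≤+ (s≤s z≤n)) ≤-refl) im<a)
  multiple-in-square⇒0 (+[1+ _ ] + +[1+ _ ] i) (_ , (_ , im<a)) =
    ⊥-elim (≤⇒≯ (a≤a*p+b*q (+≤+ (s≤s z≤n)) (+≤+ z≤n)) im<a)
  multiple-in-square⇒0 (-[1+ _ ] + +0 i) ((-a<re , _) , _) =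
    ⊥-elim (≤⇒≯ (a*p-b*q≤-a (-≤- z≤n) ≤-refl) -a<re)
  multiple-in-square⇒0 (-[1+ _ ] + +[1+ _ ] i) ((-a<re , _) , _) =
    ⊥-elim (≤⇒≯ (a*p-b*q≤-a (-≤- z≤n) (+≤+ z≤n)) -a<re)
  multiple-in-square⇒0 (+0 + -[1+ _ ] i) (_ , (-a<im , _)) =
    ⊥-elim (≤⇒≯ (a*q+b*p≤-a ≤-refl (-≤- z≤n)) -a<im)
  multiple-in-square⇒0 (-[1+ _ ] + -[1+ _ ] i) (_ , (-a<im , _)) =
    ⊥-elim (≤⇒≯ (a*q+b*p≤-a -≤+ (-≤- z≤n)) -a<im)

  multiple-∉-mixed-rect : ∀ w → ¬ Rect (- b) a 0ℤ (a + b) ((a + b i) *ᵍ w)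
  multiple-∉-mixed-rect (p + q i) ((-b<re , re<a) , (0<im , im<a+b)) with ≤0⊎1≤ p | ≤0⊎1≤ q
  ... | inj₂ 1≤p | inj₂ 1≤q = ≤⇒≯ (a+b≤a*q+b*p 1≤p 1≤q) im<a+b
  ... | inj₁ p≤0 | inj₂ 1≤q = ≤⇒≯ (a*p-b*q≤-b p≤0 1≤q) -b<re
  ... | inj₂ 1≤p | inj₁ q≤0 = ≤⇒≯ (a≤a*p-b*q 1≤p q≤0) re<a
  ... | inj₁ p≤0 | inj₁ q≤0 = ≤⇒≯ (a*q+b*p≤0 p≤0 q≤0) 0<im

  ≡mod-in-square⇒≡ : Square a (z -ᵍ w) → z ≡ w mod (a + b i) → z ≡ w
  ≡mod-in-square⇒≡ {z} {w} diff∈ (q , z-w≡mq) = -ᵍ≡0ᵍ⇒≡ (begin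
    z -ᵍ w              ≡⟨ z-w≡mq ⟩
    (a + b i) *ᵍ q      ≡⟨ cong ((a + b i) *ᵍ_) q≡0 ⟩
    (a + b i) *ᵍ 0ᵍ     ≡⟨ *ᵍ-zeroʳ (a + b i) ⟩
    0ᵍ                  ∎)
    where
    open ≡-Reasoning
    q≡0 : q ≡ 0ᵍ
    q≡0 = multiple-in-square⇒0 q (subst (Square a) z-w≡mq diff∈)

  ≢mod-in-mixed-rect : ∀ z w → Rect (- b) a 0ℤ (a + b) (z -ᵍ w) → ¬ (z ≡ w mod (a + b i))
  ≢mod-in-mixed-rect z w diff∈ (q , z-w≡mq) =
    multiple-∉-mixed-rect q (subst (Rect (- b) a 0ℤ (a + b)) z-w≡mq diff∈)

mainTheorem11 : (a b : ℤ) → b < a → + 0 ≤ b → (z w : ℤ[i]) → inS∪T a b z → inS∪T a b w → ¬ (z ≡ w) → ¬ (z ≡ w mod (a + b i))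
mainTheorem11 a b b<a 0≤b z w z∈ w∈ z≢w z≡w = by-cases z∈ w∈
  where
  instance
    a-nonNeg : NonNegative a
    a-nonNeg = nonNegative (≤-trans 0≤b (<⇒≤ b<a))
    b-nonNeg : NonNegative b
    b-nonNeg = nonNegative 0≤b
  b≤a : b ≤ a
  b≤a = <⇒≤ b<a
  by-cases : inS∪T a b z → inS∪T a b w → ⊥
  by-cases (inj₁ z∈S) (inj₁ w∈S) = z≢w (≡mod-in-square⇒≡ a b (S-S-diff z∈S w∈S) z≡w)
  by-cases (inj₂ z∈T) (inj₂ w∈T) =
    z≢w (≡mod-in-square⇒≡ a b (Square-mono b≤a (T-T-diff z∈T w∈T)) z≡w)
  by-cases (inj₁ z∈S) (inj₂ w∈T) = ≢mod-in-mixed-rect a b z w (S-T-diff z∈S w∈T) z≡w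
  by-cases (inj₂ z∈T) (inj₁ w∈S) = ≢mod-in-mixed-rect a b w z (S-T-diff w∈S z∈T) (≡mod-sym {z} {w} {a + b i} z≡w)
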